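{- Let $p$ be an odd prime, $m$ even, $M=\mathbb F_{p^m}$, $Q=p^{m/2}$, $1\le k\le m-1$, $q=p^k$, $r=p^{k+m/2}$, $m/\gcd(k,m)$ odd, $B\in M$ a non-square and $A\in M$ with $AB\in\mathbb F_Q^\times$ (so $A$ is a non-square in $M$). For $v\in M^\times$, the map $f:M\to M$, $f(x)=x^rv+Axv^r$, is bijective. -}

module Defs where

open import Level using (Level; _⊔_)
open import Data.Nat using (ℕ; zero; suc)
open import Data.Fin using (Fin)
open import Data.Product using (∃; Σ; _×_)
open import Relation.Nullary using (¬_)
open import Relation.Binary.PropositionalEquality as ≡ using (_≡_)
open import Algebra.Bundles using (CommutativeRing)
open import Function.Bundles using (Inverse)

record IsField {c ℓ : Level} (R : CommutativeRing c ℓ) : Set (c ⊔ ℓ) where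
  open CommutativeRing R
  field
    1≉0     : ¬ (1# ≈ 0#)
    inverse : ∀ x → ¬ (x ≈ 0#) → ∃ λ y → x * y ≈ 1#

HasCard : {c ℓ : Level} (R : CommutativeRing c ℓ) → ℕ → Set (c ⊔ ℓ)
HasCard R n = Inverse (CommutativeRing.setoid R) (≡.setoid (Fin n))

module FieldNotions {c ℓ : Level} (R : CommutativeRing c ℓ) where
  open CommutativeRing R

  pow : Carrier → ℕ → Carrier
  pow x zero    = 1#
  pow x (suc n) = x * pow x n

  IsSquare : Carrier → Set (c ⊔ ℓ)
  IsSquare x = ∃ λ y → y * y ≈ x

  InSubfieldUnits : ℕ → Carrier → Set ℓ
  InSubfieldUnits Q y = (pow y Q ≈ y) × ¬ (y ≈ 0#)

  fmap : (r : ℕ) (A v : Carrier) → Carrier → Carrier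
  fmap r A v x = (pow x r * v) + ((A * x) * pow v r)

-- Since r is a power of the characteristic p, f is additive, so it is bijective as soon as its
-- kernel is trivial (M is finite). If f(x) = 0 with x ≠ 0, put u = x/v: then u^(r−1) = −A, and r is
-- odd, so −A is a square. But −AB lies in F_Q^×, and every element of F_Q^× is a square in M by
-- Euler's criterion, because t^(Q−1) = 1 and (Q² − 1)/2 is a multiple of Q − 1. Hence B would be
-- a square.
module Submission where

open import Data.Nat as ℕ using (ℕ; zero; suc; z≤n; s≤s)
import Data.Nat.Properties as ℕ
open import Data.Nat.Combinatorics using (_C_; nCn≡1; nC1≡n; nCk+nC[k+1]≡[n+1]C[k+1])
open import Data.Nat.Divisibility using (_∣_; divides; ∣⇒≤; m%n≡0⇒n∣m)
open import Data.Nat.DivMod using (_%_; _/_; m≡m%n+[m/n]*n; m%n<n)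
open import Data.Nat.Primality using (Prime; euclidsLemma; ¬prime[0])
open import Data.Nat.Tactic.RingSolver using (solve-∀)
open import Data.Fin as Fin using (Fin; toℕ; fromℕ; inject₁; punchIn; punchOut)
import Data.Fin.Properties as Fin
open import Data.List using (List; []; _∷_; length; filter)
open import Data.List.Relation.Unary.All as All using (All; []; _∷_)
open import Data.List.Relation.Unary.AllPairs using (AllPairs; []; _∷_)
open import Data.Product using (∃; _,_; proj₁; proj₂)
open import Data.Sum using (_⊎_; inj₁; inj₂; [_,_])
open import Data.Empty using (⊥; ⊥-elim)
open import Function.Base using (_∘_)
open import Relation.Nullary using (¬_; Dec; yes; no; contradiction)
open import Relation.Unary using (Pred)
import Relation.Unary as U
open import Relation.Binary.PropositionalEquality as ≡ using (_≡_; _≢_)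
open import Algebra.Bundles using (Group; CommutativeRing)
open import Defs

[1+k]*[1+n]C[1+k]≡[1+n]*nCk : ∀ n k → suc k ℕ.* (suc n C suc k) ≡ suc n ℕ.* (n C k)
[1+k]*[1+n]C[1+k]≡[1+n]*nCk zero    zero    = ≡.refl
[1+k]*[1+n]C[1+k]≡[1+n]*nCk zero    (suc k) = ℕ.*-zeroʳ (suc (suc k))
[1+k]*[1+n]C[1+k]≡[1+n]*nCk (suc n) zero    =
  ≡.trans (ℕ.+-identityʳ _) (≡.trans (nC1≡n (suc (suc n))) (≡.sym (ℕ.*-identityʳ (suc (suc n)))))
[1+k]*[1+n]C[1+k]≡[1+n]*nCk (suc n) (suc k) = begin
  suc (suc k) ℕ.* (suc (suc n) C suc (suc k))
    ≡⟨ ≡.cong (suc (suc k) ℕ.*_) (nCk+nC[k+1]≡[n+1]C[k+1] (suc n) (suc k)) ⟨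
  suc (suc k) ℕ.* (a ℕ.+ b)
    ≡⟨ distribute a b k ⟩
  a ℕ.+ (suc k ℕ.* a ℕ.+ suc (suc k) ℕ.* b)
    ≡⟨ ≡.cong₂ (λ u w → a ℕ.+ (u ℕ.+ w)) ([1+k]*[1+n]C[1+k]≡[1+n]*nCk n k)
                                         ([1+k]*[1+n]C[1+k]≡[1+n]*nCk n (suc k)) ⟩
  a ℕ.+ (suc n ℕ.* (n C k) ℕ.+ suc n ℕ.* (n C suc k))
    ≡⟨ ≡.cong (a ℕ.+_) (ℕ.*-distribˡ-+ (suc n) (n C k) (n C suc k)) ⟨
  a ℕ.+ suc n ℕ.* (n C k ℕ.+ n C suc k)
    ≡⟨ ≡.cong (λ u → a ℕ.+ suc n ℕ.* u) (nCk+nC[k+1]≡[n+1]C[k+1] n k) ⟩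
  a ℕ.+ suc n ℕ.* a ∎
  where
  open ≡.≡-Reasoning
  a = suc n C suc k
  b = suc n C suc (suc k)
  distribute : ∀ a b k → suc (suc k) ℕ.* (a ℕ.+ b) ≡ a ℕ.+ (suc k ℕ.* a ℕ.+ suc (suc k) ℕ.* b)
  distribute = solve-∀

prime∣pCk : ∀ {p k} → Prime p → 0 ℕ.< k → k ℕ.< p → p ∣ p C k
prime∣pCk {suc p} {suc k} p-prime _ k<p
  with euclidsLemma (suc k) (suc p C suc k) p-prime
         (divides (p C k) (≡.trans ([1+k]*[1+n]C[1+k]≡[1+n]*nCk p k) (ℕ.*-comm (suc p) (p C k))))
... | inj₁ p∣1+k = contradiction (∣⇒≤ p∣1+k) (ℕ.<⇒≱ k<p)
... | inj₂ p∣pCk = p∣pCk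

Odd : ℕ → Set
Odd n = ∃ λ s → n ≡ suc (s ℕ.+ s)

¬2∣⇒odd : ∀ {n} → ¬ 2 ∣ n → Odd n
¬2∣⇒odd {n} 2∤n with n % 2 in n%2≡r | m%n<n n 2
... | zero        | _ = contradiction (m%n≡0⇒n∣m n 2 n%2≡r) 2∤n
... | suc zero    | _ = n / 2 , ≡.trans (m≡m%n+[m/n]*n n 2) (≡.cong₂ ℕ._+_ n%2≡r (*2≡+ (n / 2)))
  where
  *2≡+ : ∀ s → s ℕ.* 2 ≡ s ℕ.+ s
  *2≡+ = solve-∀
... | suc (suc _) | s≤s (s≤s ())

odd-* : ∀ {m n} → Odd m → Odd n → Odd (m ℕ.* n)
odd-* (a , ≡.refl) (b , ≡.refl) = a ℕ.+ b ℕ.* suc (a ℕ.+ a) , expand a b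
  where
  expand : ∀ a b → suc (a ℕ.+ a) ℕ.* suc (b ℕ.+ b)
                 ≡ suc ((a ℕ.+ b ℕ.* suc (a ℕ.+ a)) ℕ.+ (a ℕ.+ b ℕ.* suc (a ℕ.+ a)))
  expand = solve-∀

odd-^ : ∀ {m} → Odd m → ∀ j → Odd (m ℕ.^ j)
odd-^ odd zero    = 0 , ≡.refl
odd-^ odd (suc j) = odd-* odd (odd-^ odd j)

injective⇒surjective : ∀ {n} (f : Fin n → Fin n) → (∀ {i j} → f i ≡ f j → i ≡ j)
                     → ∀ y → ∃ λ x → f x ≡ y
injective⇒surjective {zero}  f inj ()
injective⇒surjective {suc n} f inj y with Fin.any? (λ i → f i Fin.≟ y)
... | yes hit  = hit
... | no  miss = contradiction (Fin.injective⇒≤ {f = f'} f'-injective) (ℕ.<-irrefl ≡.refl)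
  where
  f≢y : ∀ i → y ≡ f i → ⊥
  f≢y i y≡fi = miss (i , ≡.sym y≡fi)
  f' : Fin (suc n) → Fin n
  f' i = punchOut (f≢y i)
  f'-injective : ∀ {i j} → f' i ≡ f' j → i ≡ j
  f'-injective {i} {j} eq = inj (Fin.punchOut-injective (f≢y i) (f≢y j) eq)

allPairs-restrict : ∀ {a p r} {A : Set a} {P : Pred A p} {R : A → A → Set r} {xs : List A} →
                    All P xs → AllPairs (λ x y → P x → P y → R x y) xs → AllPairs R xs
allPairs-restrict []         []         = []
allPairs-restrict (px ∷ pxs) (rx ∷ rxs) =
  All.zipWith (λ (py , r) → r px py) (pxs , rx) ∷ allPairs-restrict pxs rxs

length≤filter+filter : ∀ {a p q} {A : Set a} {P : Pred A p} {Q : Pred A q}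
                       (P? : U.Decidable P) (Q? : U.Decidable Q) {xs : List A} →
                       All (λ x → P x ⊎ Q x) xs →
                       length xs ℕ.≤ length (filter P? xs) ℕ.+ length (filter Q? xs)
length≤filter+filter P? Q? [] = z≤n
length≤filter+filter P? Q? {x ∷ xs} (px⊎qx ∷ rest) with P? x | Q? x | length≤filter+filter P? Q? rest
... | yes _ | yes _ | ih = s≤s (ℕ.≤-trans ih (ℕ.+-monoʳ-≤ (length (filter P? xs)) (ℕ.n≤1+n _)))
... | yes _ | no  _ | ih = s≤s ih
... | no  _ | yes _ | ih = ℕ.≤-trans (s≤s ih) (ℕ.≤-reflexive (≡.sym (ℕ.+-suc (length (filter P? xs)) _)))
... | no ¬p | no ¬q | _  = contradiction px⊎qx [ ¬p , ¬q ]

module GroupHomomorphism {c ℓ} (G : Group c ℓ) where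
  open Group G
  open import Algebra.Properties.Group G using (identityʳ-unique; inverseʳ-unique; x∙y⁻¹≈ε⇒x≈y)
  open import Relation.Binary.Reasoning.Setoid setoid

  module _ {f : Carrier → Carrier} (f-cong : ∀ {x y} → x ≈ y → f x ≈ f y)
           (f-homo : ∀ x y → f (x ∙ y) ≈ f x ∙ f y) where

    ε-homo : f ε ≈ ε
    ε-homo = identityʳ-unique (f ε) (f ε) (begin
      f ε ∙ f ε  ≈⟨ f-homo ε ε ⟨
      f (ε ∙ ε)  ≈⟨ f-cong (identityʳ ε) ⟩
      f ε        ∎)

    ⁻¹-homo : ∀ x → f (x ⁻¹) ≈ f x ⁻¹
    ⁻¹-homo x = inverseʳ-unique (f x) (f (x ⁻¹)) (begin
      f x ∙ f (x ⁻¹)  ≈⟨ f-homo x (x ⁻¹) ⟨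
      f (x ∙ x ⁻¹)    ≈⟨ f-cong (inverseʳ x) ⟩
      f ε             ≈⟨ ε-homo ⟩
      ε               ∎)

    trivial-kernel⇒injective : (∀ x → f x ≈ ε → x ≈ ε) → ∀ {x y} → f x ≈ f y → x ≈ y
    trivial-kernel⇒injective ker {x} {y} fx≈fy = x∙y⁻¹≈ε⇒x≈y x y (ker (x ∙ y ⁻¹) (begin
      f (x ∙ y ⁻¹)     ≈⟨ f-homo x (y ⁻¹) ⟩
      f x ∙ f (y ⁻¹)   ≈⟨ ∙-cong fx≈fy (⁻¹-homo y) ⟩
      f y ∙ f y ⁻¹     ≈⟨ inverseʳ (f y) ⟩
      ε                ∎))

module Frobenius {c ℓ} (R : CommutativeRing c ℓ) where
  open CommutativeRing R
  open import Algebra.Properties.Semiring.Mult semiring using (_×_; ×-assocˡ; ×-assoc-*; ×-congˡ; ×-congʳ)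
  open import Algebra.Properties.Semiring.Exp semiring using (_^_; ^-congˡ; ^-assocʳ)
  open import Algebra.Properties.CommutativeSemiring.Binomial commutativeSemiring using (theorem; binomialTerm)
  open import Algebra.Properties.Monoid.Sum +-monoid using (sum; sum-init-last; sum-cong-≋; sum-replicate-zero)
  open import Data.Vec.Functional using (Vector; init; replicate)
  open import Relation.Binary.Reasoning.Setoid setoid
  open GroupHomomorphism +-group using (⁻¹-homo)

  char⇒∣⇒×≈0 : ∀ {p m} → p × 1# ≈ 0# → p ∣ m → ∀ x → m × x ≈ 0#
  char⇒∣⇒×≈0 {p} char (divides d ≡.refl) x = begin
    (d ℕ.* p) × x       ≈⟨ ×-congˡ (ℕ.*-comm d p) ⟩
    (p ℕ.* d) × x       ≈⟨ ×-assocˡ x p d ⟨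
    p × (d × x)         ≈⟨ ×-congʳ p (*-identityˡ _) ⟨
    p × (1# * (d × x))  ≈⟨ ×-assoc-* p 1# (d × x) ⟨
    (p × 1#) * (d × x)  ≈⟨ *-congʳ char ⟩
    0# * (d × x)        ≈⟨ zeroˡ _ ⟩
    0#                  ∎

  sum≈first+last : ∀ {n} (t : Vector Carrier (suc (suc n))) → (∀ i → t (Fin.suc (inject₁ i)) ≈ 0#)
                 → sum t ≈ t Fin.zero + t (fromℕ (suc n))
  sum≈first+last {n} t inner≈0 = +-congˡ (begin
    sum (t ∘ Fin.suc)                             ≈⟨ sum-init-last (t ∘ Fin.suc) ⟩
    sum (init (t ∘ Fin.suc)) + t (fromℕ (suc n))  ≈⟨ +-congʳ (sum-cong-≋ {y = replicate n 0#} inner≈0) ⟩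
    sum (replicate n 0#) + t (fromℕ (suc n))      ≈⟨ +-congʳ (sum-replicate-zero n) ⟩
    0# + t (fromℕ (suc n))                        ≈⟨ +-identityˡ _ ⟩
    t (fromℕ (suc n))                             ∎)

  frobenius : ∀ {p} → Prime p → p × 1# ≈ 0# → ∀ x y → (x + y) ^ p ≈ x ^ p + y ^ p
  frobenius {zero}  p-prime = contradiction p-prime ¬prime[0]
  frobenius {suc p} p-prime char x y = begin
    (x + y) ^ suc p                               ≈⟨ theorem (suc p) x y ⟩
    sum term                                      ≈⟨ sum≈first+last term inner≈0 ⟩
    term Fin.zero + term (fromℕ (suc p))          ≈⟨ +-cong first≈y^p last≈x^p ⟩
    y ^ suc p + x ^ suc p                         ≈⟨ +-comm _ _ ⟩
    x ^ suc p + y ^ suc p                         ∎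
    where
    term = binomialTerm x y (suc p)
    first≈y^p : term Fin.zero ≈ y ^ suc p
    first≈y^p = trans (+-identityʳ _) (*-identityˡ _)
    last≈x^p : term (fromℕ (suc p)) ≈ x ^ suc p
    last≈x^p rewrite Fin.toℕ-fromℕ p | nCn≡1 (suc p) | ℕ.n∸n≡0 (suc p) =
      trans (+-identityʳ _) (*-identityʳ _)
    inner≈0 : ∀ i → term (Fin.suc (inject₁ i)) ≈ 0#
    inner≈0 i = char⇒∣⇒×≈0 char (prime∣pCk p-prime (s≤s z≤n) (s≤s i<p)) _
      where
      i<p : toℕ (inject₁ i) ℕ.< p
      i<p = ℕ.≤-trans (ℕ.≤-reflexive (≡.cong suc (Fin.toℕ-inject₁ i))) (Fin.toℕ<n i)

  module _ {p} (p-prime : Prime p) (char : p × 1# ≈ 0#) where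

    frobenius-^ : ∀ j x y → (x + y) ^ (p ℕ.^ j) ≈ x ^ (p ℕ.^ j) + y ^ (p ℕ.^ j)
    frobenius-^ zero    x y = trans (*-identityʳ _) (+-cong (sym (*-identityʳ x)) (sym (*-identityʳ y)))
    frobenius-^ (suc j) x y = begin
      (x + y) ^ (p ℕ.* q)              ≈⟨ ^-assocʳ (x + y) p q ⟨
      ((x + y) ^ p) ^ q                ≈⟨ ^-congˡ q (frobenius p-prime char x y) ⟩
      (x ^ p + y ^ p) ^ q              ≈⟨ frobenius-^ j (x ^ p) (y ^ p) ⟩
      (x ^ p) ^ q + (y ^ p) ^ q        ≈⟨ +-cong (^-assocʳ x p q) (^-assocʳ y p q) ⟩
      x ^ (p ℕ.* q) + y ^ (p ℕ.* q)    ∎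
      where q = p ℕ.^ j

    frobenius-^-neg : ∀ j x → (- x) ^ (p ℕ.^ j) ≈ - (x ^ (p ℕ.^ j))
    frobenius-^-neg j = ⁻¹-homo (^-congˡ (p ℕ.^ j)) (frobenius-^ j)

module Field {c ℓ} (M : CommutativeRing c ℓ) (isField : IsField M) where
  open CommutativeRing M
  open IsField isField
  open FieldNotions M
  open import Algebra.Properties.Semiring.Exp semiring using (_^_)
  open import Algebra.Properties.Ring ring using ([y-z]x≈yx-zx)
  open import Algebra.Properties.Group +-group using (x∙y⁻¹≈ε⇒x≈y)
  open import Algebra.Solver.Ring.NaturalCoefficients.Default commutativeSemiring
  import Algebra.Properties.CommutativeMonoid.Sum
  open import Relation.Binary.Reasoning.Setoid setoid
  module Π = Algebra.Properties.CommutativeMonoid.Sum *-commutativeMonoid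

  *-cancelˡ : ∀ {x y z} → x ≉ 0# → x * y ≈ x * z → y ≈ z
  *-cancelˡ {x} {y} {z} x≉0 xy≈xz with inverse x x≉0
  ... | x⁻¹ , x*x⁻¹≈1 = begin
    y               ≈⟨ undo y ⟨
    x⁻¹ * (x * y)   ≈⟨ *-congˡ xy≈xz ⟩
    x⁻¹ * (x * z)   ≈⟨ undo z ⟩
    z               ∎
    where
    undo : ∀ w → x⁻¹ * (x * w) ≈ w
    undo w = begin
      x⁻¹ * (x * w)   ≈⟨ solve 3 (λ x x⁻¹ w → x⁻¹ :* (x :* w) := (x :* x⁻¹) :* w) refl x x⁻¹ w ⟩
      (x * x⁻¹) * w   ≈⟨ *-congʳ x*x⁻¹≈1 ⟩
      1# * w          ≈⟨ *-identityˡ w ⟩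
      w               ∎

  x*y≈0⇒y≈0 : ∀ {x y} → x ≉ 0# → x * y ≈ 0# → y ≈ 0#
  x*y≈0⇒y≈0 {x} x≉0 xy≈0 = *-cancelˡ x≉0 (trans xy≈0 (sym (zeroʳ x)))

  *-≉0 : ∀ {x y} → x ≉ 0# → y ≉ 0# → x * y ≉ 0#
  *-≉0 x≉0 y≉0 xy≈0 = y≉0 (x*y≈0⇒y≈0 x≉0 xy≈0)

  ^-≉0 : ∀ {x} → x ≉ 0# → ∀ k → x ^ k ≉ 0#
  ^-≉0 x≉0 zero    = 1≉0
  ^-≉0 x≉0 (suc k) = *-≉0 x≉0 (^-≉0 x≉0 k)

  x*z≈y*z⇒z≈0 : ∀ {a b q} → a ≉ b → a * q ≈ b * q → q ≈ 0#
  x*z≈y*z⇒z≈0 {a} {b} {q} a≉b aq≈bq = x*y≈0⇒y≈0 a-b≉0 (begin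
    (a - b) * q        ≈⟨ [y-z]x≈yx-zx q a b ⟩
    a * q - b * q      ≈⟨ +-congʳ aq≈bq ⟩
    b * q - b * q      ≈⟨ -‿inverseʳ (b * q) ⟩
    0#                 ∎)
    where
    a-b≉0 : a - b ≉ 0#
    a-b≉0 a-b≈0 = a≉b (x∙y⁻¹≈ε⇒x≈y a b a-b≈0)

  pow≈^ : ∀ x k → pow x k ≈ x ^ k
  pow≈^ x zero    = refl
  pow≈^ x (suc k) = *-congˡ (pow≈^ x k)

  square-cancelˡ : ∀ {w x} → w ≉ 0# → IsSquare ((w * w) * x) → IsSquare x
  square-cancelˡ {w} {x} w≉0 (σ , σσ≈wwx) with inverse w w≉0
  ... | w⁻¹ , w*w⁻¹≈1 = σ * w⁻¹ , (begin
    (σ * w⁻¹) * (σ * w⁻¹)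
      ≈⟨ solve 2 (λ σ w⁻¹ → (σ :* w⁻¹) :* (σ :* w⁻¹) := (σ :* σ) :* (w⁻¹ :* w⁻¹)) refl σ w⁻¹ ⟩
    (σ * σ) * (w⁻¹ * w⁻¹)
      ≈⟨ *-congʳ σσ≈wwx ⟩
    ((w * w) * x) * (w⁻¹ * w⁻¹)
      ≈⟨ solve 3 (λ w x w⁻¹ → ((w :* w) :* x) :* (w⁻¹ :* w⁻¹) := ((w :* w⁻¹) :* (w :* w⁻¹)) :* x)
                 refl w x w⁻¹ ⟩
    ((w * w⁻¹) * (w * w⁻¹)) * x
      ≈⟨ *-congʳ (trans (*-cong w*w⁻¹≈1 w*w⁻¹≈1) (*-identityˡ 1#)) ⟩
    1# * x
      ≈⟨ *-identityˡ x ⟩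
    x ∎)

  product-≉0 : ∀ {k} (f : Fin k → Carrier) → (∀ j → f j ≉ 0#) → Π.sum f ≉ 0#
  product-≉0 {zero}  f f≉0 = 1≉0
  product-≉0 {suc k} f f≉0 = *-≉0 (f≉0 Fin.zero) (product-≉0 (f ∘ Fin.suc) (f≉0 ∘ Fin.suc))

  product-scale : ∀ a {k} (f : Fin k → Carrier) → Π.sum (λ j → a * f j) ≈ a ^ k * Π.sum f
  product-scale a {zero}  f = sym (*-identityʳ 1#)
  product-scale a {suc k} f = begin
    (a * f₀) * Π.sum (λ j → a * f (Fin.suc j))   ≈⟨ *-congˡ (product-scale a (f ∘ Fin.suc)) ⟩
    (a * f₀) * (a ^ k * Π.sum (f ∘ Fin.suc))     ≈⟨ interchange a f₀ (a ^ k) _ ⟩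
    (a * a ^ k) * (f₀ * Π.sum (f ∘ Fin.suc))     ∎
    where
    f₀ = f Fin.zero
    interchange : ∀ a b c d → (a * b) * (c * d) ≈ (a * c) * (b * d)
    interchange = solve 4 (λ a b c d → (a :* b) :* (c :* d) := (a :* c) :* (b :* d)) refl

  -- A list c₀ ∷ … ∷ c_{d-1} stands for the monic polynomial c₀ + c₁ X + … + c_{d-1} X^{d-1} + X^d.
  module MonicPolynomial where
    open import Data.List using (replicate)
    import Data.List.Properties as List

    eval : List Carrier → Carrier → Carrier
    eval []       x = 1#
    eval (c ∷ cs) x = c + x * eval cs x

    -- synthetic division by X - a
    quotient : List Carrier → Carrier → List Carrier
    quotient []            a = []
    quotient (c ∷ [])      a = []
    quotient (c ∷ c′ ∷ cs) a = eval (c′ ∷ cs) a ∷ quotient (c′ ∷ cs) a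

    length-quotient : ∀ c cs a → length (quotient (c ∷ cs) a) ≡ length cs
    length-quotient c []        a = ≡.refl
    length-quotient c (c′ ∷ cs) a = ≡.cong suc (length-quotient c′ cs a)

    -- P(x) − P(a) = (x − a) Q(x), with both sides moved so that no subtraction occurs.
    division : ∀ c cs a x → eval (c ∷ cs) x + a * eval (quotient (c ∷ cs) a) x
                          ≈ x * eval (quotient (c ∷ cs) a) x + eval (c ∷ cs) a
    division c [] a x =
      solve 3 (λ c a x → (c :+ x :* con 1) :+ a :* con 1 := x :* con 1 :+ (c :+ a :* con 1)) refl c a x
    division c (c′ ∷ cs) a x = begin
      (c + x * Rx) + a * (Ra + x * Qx)   ≈⟨ regroup c x Rx a Ra Qx ⟩
      (c + a * Ra) + x * (Rx + a * Qx)   ≈⟨ +-congˡ (*-congˡ (division c′ cs a x)) ⟩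
      (c + a * Ra) + x * (x * Qx + Ra)   ≈⟨ collect c x a Ra Qx ⟩
      x * (Ra + x * Qx) + (c + a * Ra)   ∎
      where
      Rx = eval (c′ ∷ cs) x
      Ra = eval (c′ ∷ cs) a
      Qx = eval (quotient (c′ ∷ cs) a) x
      regroup : ∀ c x Rx a Ra Qx → (c + x * Rx) + a * (Ra + x * Qx) ≈ (c + a * Ra) + x * (Rx + a * Qx)
      regroup = solve 6 (λ c x Rx a Ra Qx → (c :+ x :* Rx) :+ a :* (Ra :+ x :* Qx)
                                         := (c :+ a :* Ra) :+ x :* (Rx :+ a :* Qx)) refl
      collect : ∀ c x a Ra Qx → (c + a * Ra) + x * (x * Qx + Ra) ≈ x * (Ra + x * Qx) + (c + a * Ra)
      collect = solve 5 (λ c x a Ra Qx → (c :+ a :* Ra) :+ x :* (x :* Qx :+ Ra)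
                                      := x :* (Ra :+ x :* Qx) :+ (c :+ a :* Ra)) refl

    quotient-root : ∀ {c cs a b} → eval (c ∷ cs) a ≈ 0# → eval (c ∷ cs) b ≈ 0# → a ≉ b
                  → eval (quotient (c ∷ cs) a) b ≈ 0#
    quotient-root {c} {cs} {a} {b} Pa≈0 Pb≈0 a≉b = x*z≈y*z⇒z≈0 a≉b (begin
      a * Qb                     ≈⟨ +-identityˡ _ ⟨
      0# + a * Qb                ≈⟨ +-congʳ Pb≈0 ⟨
      eval (c ∷ cs) b + a * Qb   ≈⟨ division c cs a b ⟩
      b * Qb + eval (c ∷ cs) a   ≈⟨ +-congˡ Pa≈0 ⟩
      b * Qb + 0#                ≈⟨ +-identityʳ _ ⟩
      b * Qb                     ∎)
      where Qb = eval (quotient (c ∷ cs) a) b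

    roots≤degree : ∀ cs {as} → AllPairs _≉_ as → All (λ a → eval cs a ≈ 0#) as
                 → length as ℕ.≤ length cs
    roots≤degree cs       {[]}     _ _ = z≤n
    roots≤degree []       {a ∷ as} _ (1≈0 ∷ _) = contradiction 1≈0 1≉0
    roots≤degree (c ∷ cs) {a ∷ as} (a≉as ∷ distinct) (Pa≈0 ∷ Pas≈0) = s≤s (ℕ.≤-trans
      (roots≤degree (quotient (c ∷ cs) a) distinct
         (All.zipWith (λ (Pb≈0 , a≉b) → quotient-root {c} {cs} Pa≈0 Pb≈0 a≉b) (Pas≈0 , a≉as)))
      (ℕ.≤-reflexive (length-quotient c cs a)))

    X^[1+_]-1 : ℕ → List Carrier
    X^[1+ d ]-1 = - 1# ∷ replicate d 0#

    length-X^[1+_]-1 : ∀ d → length X^[1+ d ]-1 ≡ suc d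
    length-X^[1+_]-1 d = ≡.cong suc (List.length-replicate d)

    root-X^[1+_]-1 : ∀ d {x} → x ^ suc d ≈ 1# → eval X^[1+ d ]-1 x ≈ 0#
    root-X^[1+_]-1 d {x} x^[1+d]≈1 = begin
      - 1# + x * eval (replicate d 0#) x   ≈⟨ +-congˡ (*-congˡ (eval-Xᵈ d)) ⟩
      - 1# + x ^ suc d                     ≈⟨ +-congˡ x^[1+d]≈1 ⟩
      - 1# + 1#                            ≈⟨ -‿inverseˡ 1# ⟩
      0#                                   ∎
      where
      eval-Xᵈ : ∀ d → eval (replicate d 0#) x ≈ x ^ d
      eval-Xᵈ zero    = refl
      eval-Xᵈ (suc d) = trans (+-identityˡ _) (*-congˡ (eval-Xᵈ d))

  module Finite {n} (card : HasCard M (suc n)) where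
    open import Data.Fin.Permutation using (Permutation′; permutation)
    open import Data.List using (tabulate; map)
    import Data.List.Properties as List
    import Data.List.Relation.Unary.All.Properties as Allₚ
    import Data.List.Relation.Unary.AllPairs as AllPairs
    import Data.List.Relation.Unary.AllPairs.Properties as AllPairsₚ
    import Algebra.Properties.CommutativeMonoid.Sum as Sum
    open import Algebra.Properties.Semiring.Mult semiring using (_×_; ×-homo-+; ×1-homo-*)
    open import Algebra.Properties.Semiring.Exp semiring using (^-homo-*; ^-assocʳ; ^-congˡ)
    open import Algebra.Properties.CommutativeSemiring.Exp commutativeSemiring using (^-distrib-*)
    open import Algebra.Properties.Group +-group using (identityʳ-unique; inverseʳ-unique)
    open import Function.Bundles using (Inverse)
    open import Function.Definitions using (Bijective)
    open import Relation.Binary.Definitions using (Decidable; tri<; tri≈; tri>)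
    open MonicPolynomial
    module Σ = Sum +-commutativeMonoid
    private module I = Inverse card

    enum : Fin (suc n) → Carrier
    enum = I.from

    index : Carrier → Fin (suc n)
    index = I.to

    index-enum : ∀ i → index (enum i) ≡ i
    index-enum i = I.inverseˡ refl

    enum-index : ∀ x → enum (index x) ≈ x
    enum-index x = I.inverseʳ ≡.refl

    index-injective : ∀ {x y} → index x ≡ index y → x ≈ y
    index-injective {x} {y} eq = trans (sym (enum-index x)) (trans (reflexive (≡.cong enum eq)) (enum-index y))

    enum-injective : ∀ {i j} → enum i ≈ enum j → i ≡ j
    enum-injective {i} {j} eq = ≡.trans (≡.sym (index-enum i)) (≡.trans (I.to-cong eq) (index-enum j))

    infix 4 _≈?_
    _≈?_ : Decidable _≈_
    x ≈? y with index x Fin.≟ index y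
    ... | yes eq  = yes (index-injective eq)
    ... | no  neq = no (neq ∘ I.to-cong)

    n≢0 : n ≢ 0
    n≢0 n≡0 = 1≉0 (index-injective (Fin.toℕ-injective (≡.trans (toℕ≡0 _) (≡.sym (toℕ≡0 _)))))
      where
      toℕ≡0 : ∀ i → toℕ i ≡ 0
      toℕ≡0 i = ℕ.n<1⇒n≡0 (≡.subst (λ k → toℕ i ℕ.< suc k) n≡0 (Fin.toℕ<n i))

    ^≈0⇒≈0 : ∀ {x} k → x ^ k ≈ 0# → x ≈ 0#
    ^≈0⇒≈0 {x} k x^k≈0 with x ≈? 0#
    ... | yes x≈0 = x≈0
    ... | no  x≉0 = contradiction x^k≈0 (^-≉0 x≉0 k)

    inducedPermutation : (φ ψ : Carrier → Carrier) →
                         (∀ {x y} → x ≈ y → φ x ≈ φ y) → (∀ {x y} → x ≈ y → ψ x ≈ ψ y) →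
                         (∀ x → φ (ψ x) ≈ x) → (∀ x → ψ (φ x) ≈ x) → Permutation′ (suc n)
    inducedPermutation φ ψ φ-cong ψ-cong φψ≈id ψφ≈id =
      permutation (λ i → index (φ (enum i))) (λ j → index (ψ (enum j)))
        (λ j → ≡.trans (I.to-cong (trans (φ-cong (enum-index _)) (φψ≈id _))) (index-enum j))
        (λ j → ≡.trans (I.to-cong (trans (ψ-cong (enum-index _)) (ψφ≈id _))) (index-enum j))

    -- Shifting every element by 1 permutes M, so Σ x = Σ (x + 1) = Σ x + |M|·1.
    card×1≈0 : suc n × 1# ≈ 0#
    card×1≈0 = identityʳ-unique total (suc n × 1#) (sym (begin
      total                                        ≈⟨ Σ.sum-permute enum shift ⟩
      Σ.sum (λ i → enum (index (enum i + 1#)))     ≈⟨ Σ.sum-cong-≋ (λ i → enum-index (enum i + 1#)) ⟩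
      Σ.sum (λ i → enum i + 1#)                    ≈⟨ Σ.∑-distrib-+ {suc n} enum (λ _ → 1#) ⟩
      total + Σ.sum {suc n} (λ _ → 1#)             ≈⟨ +-congˡ (Σ.sum-replicate (suc n)) ⟩
      total + suc n × 1#                           ∎))
      where
      total = Σ.sum enum
      shift = inducedPermutation (_+ 1#) (_+ - 1#) +-congʳ +-congʳ
        (λ x → trans (+-assoc x (- 1#) 1#) (trans (+-congˡ (-‿inverseˡ 1#)) (+-identityʳ x)))
        (λ x → trans (+-assoc x 1# (- 1#)) (trans (+-congˡ (-‿inverseʳ 1#)) (+-identityʳ x)))

    ×1-homo-^ : ∀ p m → (p ℕ.^ m) × 1# ≈ (p × 1#) ^ m
    ×1-homo-^ p zero    = +-identityʳ 1#
    ×1-homo-^ p (suc m) = trans (×1-homo-* p (p ℕ.^ m)) (*-congˡ (×1-homo-^ p m))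

    characteristic : ∀ {p m} → suc n ≡ p ℕ.^ m → p × 1# ≈ 0#
    characteristic {p} {m} card≡pᵐ = ^≈0⇒≈0 m (begin
      (p × 1#) ^ m        ≈⟨ ×1-homo-^ p m ⟨
      (p ℕ.^ m) × 1#      ≈⟨ reflexive (≡.cong (_× 1#) card≡pᵐ) ⟨
      suc n × 1#          ≈⟨ card×1≈0 ⟩
      0#                  ∎)

    two≉0 : ∀ {e} → n ≡ e ℕ.+ e → 1# + 1# ≉ 0#
    two≉0 {e} n≡e+e 2≈0 = 1≉0 (begin
      1#                                     ≈⟨ +-identityʳ 1# ⟨
      1# + 0#                                ≈⟨ +-congˡ (zeroʳ (e × 1#)) ⟨
      1# + (e × 1#) * 0#                     ≈⟨ +-congˡ (*-congˡ 2≈0) ⟨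
      1# + (e × 1#) * (1# + 1#)              ≈⟨ +-congˡ (distribˡ (e × 1#) 1# 1#) ⟩
      1# + ((e × 1#) * 1# + (e × 1#) * 1#)   ≈⟨ +-congˡ (+-cong (*-identityʳ _) (*-identityʳ _)) ⟩
      1# + (e × 1# + e × 1#)                 ≈⟨ +-congˡ (×-homo-+ 1# e e) ⟨
      suc (e ℕ.+ e) × 1#                     ≈⟨ reflexive (≡.cong (λ k → suc k × 1#) n≡e+e) ⟨
      suc n × 1#                             ≈⟨ card×1≈0 ⟩
      0#                                     ∎)

    zeroToOne : Carrier → Carrier
    zeroToOne x with x ≈? 0#
    ... | yes _ = 1#
    ... | no  _ = x

    zeroToOne-≈0 : ∀ {x} → x ≈ 0# → zeroToOne x ≈ 1#
    zeroToOne-≈0 {x} x≈0 with x ≈? 0#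
    ... | yes _   = refl
    ... | no  x≉0 = contradiction x≈0 x≉0

    zeroToOne-≉0 : ∀ {x} → x ≉ 0# → zeroToOne x ≈ x
    zeroToOne-≉0 {x} x≉0 with x ≈? 0#
    ... | yes x≈0 = contradiction x≈0 x≉0
    ... | no  _   = refl

    zeroToOne-cong : ∀ {x y} → x ≈ y → zeroToOne x ≈ zeroToOne y
    zeroToOne-cong {x} {y} x≈y with x ≈? 0#
    ... | yes x≈0 = sym (zeroToOne-≈0 (trans (sym x≈y) x≈0))
    ... | no  x≉0 = trans x≈y (sym (zeroToOne-≉0 (x≉0 ∘ trans x≈y)))

    nonzero : Fin n → Carrier
    nonzero j = enum (punchIn (index 0#) j)

    nonzero-≉0 : ∀ j → nonzero j ≉ 0#
    nonzero-≉0 j ≈0 = Fin.punchInᵢ≢i (index 0#) j (≡.trans (≡.sym (index-enum _)) (I.to-cong ≈0))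

    product-zeroToOne : (g : Fin (suc n) → Carrier) → g (index 0#) ≈ 0#
                      → (∀ j → g (punchIn (index 0#) j) ≉ 0#)
                      → Π.sum (zeroToOne ∘ g) ≈ Π.sum (g ∘ punchIn (index 0#))
    product-zeroToOne g g₀≈0 g≉0 = begin
      Π.sum (zeroToOne ∘ g)
        ≈⟨ Π.sum-remove (zeroToOne ∘ g) ⟩
      zeroToOne (g (index 0#)) * Π.sum (zeroToOne ∘ g ∘ punchIn (index 0#))
        ≈⟨ *-cong (zeroToOne-≈0 g₀≈0) (Π.sum-cong-≋ (zeroToOne-≉0 ∘ g≉0)) ⟩
      1# * Π.sum (g ∘ punchIn (index 0#))
        ≈⟨ *-identityˡ _ ⟩
      Π.sum (g ∘ punchIn (index 0#)) ∎

    -- x ↦ a x permutes M and fixes 0, so ∏_{x ≠ 0} x = ∏_{x ≠ 0} a x = aⁿ ∏_{x ≠ 0} x.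
    fermat : ∀ {a} → a ≉ 0# → a ^ n ≈ 1#
    fermat {a} a≉0 with inverse a a≉0
    ... | a⁻¹ , a*a⁻¹≈1 = sym (*-cancelˡ (product-≉0 nonzero nonzero-≉0) (begin
      W * 1#    ≈⟨ *-identityʳ W ⟩
      W         ≈⟨ W≈aⁿW ⟩
      a ^ n * W ≈⟨ *-comm _ _ ⟩
      W * a ^ n ∎))
      where
      W = Π.sum nonzero
      a⁻¹a≈1 : a⁻¹ * a ≈ 1#
      a⁻¹a≈1 = trans (*-comm a⁻¹ a) a*a⁻¹≈1
      scale = inducedPermutation (a *_) (a⁻¹ *_) *-congˡ *-congˡ
        (λ x → trans (sym (*-assoc a a⁻¹ x)) (trans (*-congʳ a*a⁻¹≈1) (*-identityˡ x)))
        (λ x → trans (sym (*-assoc a⁻¹ a x)) (trans (*-congʳ a⁻¹a≈1) (*-identityˡ x)))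
      W≈aⁿW : W ≈ a ^ n * W
      W≈aⁿW = begin
        W
          ≈⟨ product-zeroToOne enum (enum-index 0#) nonzero-≉0 ⟨
        Π.sum (zeroToOne ∘ enum)
          ≈⟨ Π.sum-permute (zeroToOne ∘ enum) scale ⟩
        Π.sum (λ i → zeroToOne (enum (index (a * enum i))))
          ≈⟨ Π.sum-cong-≋ (λ i → zeroToOne-cong (enum-index (a * enum i))) ⟩
        Π.sum (λ i → zeroToOne (a * enum i))
          ≈⟨ product-zeroToOne (λ i → a * enum i) (trans (*-congˡ (enum-index 0#)) (zeroʳ a))
                                (λ j → *-≉0 a≉0 (nonzero-≉0 j)) ⟩
        Π.sum (λ j → a * nonzero j)
          ≈⟨ product-scale a nonzero ⟩
        a ^ n * W ∎

    isSquare? : ∀ x → Dec (IsSquare x)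
    isSquare? x with Fin.any? (λ i → enum i * enum i ≈? x)
    ... | yes (i , ii≈x) = yes (enum i , ii≈x)
    ... | no  none       = no λ (y , yy≈x) → none (index y , trans (*-cong (enum-index y) (enum-index y)) yy≈x)

    -x≉x : 1# + 1# ≉ 0# → ∀ {x} → x ≉ 0# → - x ≉ x
    -x≉x 2≉0 {x} x≉0 -x≈x = x≉0 (x*y≈0⇒y≈0 2≉0 (begin
      (1# + 1#) * x    ≈⟨ distribʳ x 1# 1# ⟩
      1# * x + 1# * x  ≈⟨ +-cong (*-identityˡ x) (trans (*-identityˡ x) (sym -x≈x)) ⟩
      x + - x          ≈⟨ -‿inverseʳ x ⟩
      0#               ∎))

    x*x≈y*y⇒x≈y⊎x+y≈0 : ∀ {x y} → x * x ≈ y * y → x ≈ y ⊎ x + y ≈ 0#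
    x*x≈y*y⇒x≈y⊎x+y≈0 {x} {y} xx≈yy with x ≈? y
    ... | yes x≈y = inj₁ x≈y
    ... | no  x≉y = inj₂ (x*y≈0⇒y≈0 (x≉y ∘ x∙y⁻¹≈ε⇒x≈y x y) (begin
      (x - y) * (x + y)             ≈⟨ [y-z]x≈yx-zx (x + y) x y ⟩
      x * (x + y) - y * (x + y)     ≈⟨ +-congˡ (-‿cong y[x+y]≈x[x+y]) ⟩
      x * (x + y) - x * (x + y)     ≈⟨ -‿inverseʳ _ ⟩
      0#                            ∎))
      where
      y[x+y]≈x[x+y] : y * (x + y) ≈ x * (x + y)
      y[x+y]≈x[x+y] = begin
        y * (x + y)     ≈⟨ distribˡ y x y ⟩
        y * x + y * y   ≈⟨ +-cong (*-comm y x) (sym xx≈yy) ⟩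
        x * y + x * x   ≈⟨ +-comm _ _ ⟩
        x * x + x * y   ≈⟨ distribˡ x x y ⟨
        x * (x + y)     ∎

    nonzeros : List Carrier
    nonzeros = tabulate nonzero

    nonzeros-distinct : AllPairs _≉_ nonzeros
    nonzeros-distinct = AllPairsₚ.tabulate⁺ λ {i} {j} i≢j →
      i≢j ∘ Fin.punchIn-injective (index 0#) i j ∘ enum-injective

    nonzeros-≉0 : All (_≉ 0#) nonzeros
    nonzeros-≉0 = Allₚ.tabulate⁺ nonzero-≉0

    -- x and -x are told apart by their positions in the enumeration of M.
    Upper Lower : Pred Carrier _
    Upper x = toℕ (index (- x)) ℕ.< toℕ (index x)
    Lower x = toℕ (index x) ℕ.< toℕ (index (- x))

    Upper? : U.Decidable Upper
    Upper? x = toℕ (index (- x)) ℕ.<? toℕ (index x)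

    Lower? : U.Decidable Lower
    Lower? x = toℕ (index x) ℕ.<? toℕ (index (- x))

    upper⊎lower : 1# + 1# ≉ 0# → ∀ {x} → x ≉ 0# → Upper x ⊎ Lower x
    upper⊎lower 2≉0 {x} x≉0 with ℕ.<-cmp (toℕ (index (- x))) (toℕ (index x))
    ... | tri< upper _ _ = inj₁ upper
    ... | tri≈ _ same _  = contradiction (index-injective (Fin.toℕ-injective same)) (-x≉x 2≉0 x≉0)
    ... | tri> _ _ lower = inj₂ lower

    index-neg : ∀ {x y} → x + y ≈ 0# → index (- x) ≡ index y
    index-neg {x} {y} x+y≈0 = I.to-cong (sym (inverseʳ-unique x y x+y≈0))

    upper-no-antipodes : ∀ {x y} → Upper x → Upper y → x + y ≈ 0# → ⊥
    upper-no-antipodes {x} {y} ux uy x+y≈0 = ℕ.<-asym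
      (≡.subst (λ i → toℕ i ℕ.< toℕ (index x)) (index-neg x+y≈0) ux)
      (≡.subst (λ i → toℕ i ℕ.< toℕ (index y)) (index-neg (trans (+-comm y x) x+y≈0)) uy)

    lower-no-antipodes : ∀ {x y} → Lower x → Lower y → x + y ≈ 0# → ⊥
    lower-no-antipodes {x} {y} lx ly x+y≈0 = ℕ.<-asym
      (≡.subst (λ i → toℕ (index x) ℕ.< toℕ i) (index-neg x+y≈0) lx)
      (≡.subst (λ i → toℕ (index y) ℕ.< toℕ i) (index-neg (trans (+-comm y x) x+y≈0)) ly)

    -- Euler's criterion by counting: on a class of nonzero elements without antipodes squaring is
    -- injective, so a non-square root t of X^e − 1 together with the squares of the class gives
    -- distinct roots, and the class has at most e − 1 elements. Upper and Lower cover all 2e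
    -- nonzero elements, a contradiction.
    module _ {p} {C : Pred Carrier p} (C? : U.Decidable C)
             (no-antipodes : ∀ {x y} → C x → C y → x + y ≈ 0# → ⊥)
             {d t} (n≡e+e : n ≡ suc d ℕ.+ suc d) (t-nonsquare : ¬ IsSquare t) (t^e≈1 : t ^ suc d ≈ 1#)
             where

      squares-distinct : ∀ {x y} → x ≉ y → C x → C y → x * x ≉ y * y
      squares-distinct x≉y cx cy xx≈yy with x*x≈y*y⇒x≈y⊎x+y≈0 xx≈yy
      ... | inj₁ x≈y   = x≉y x≈y
      ... | inj₂ x+y≈0 = no-antipodes cx cy x+y≈0

      square-root : ∀ {x} → x ≉ 0# → (x * x) ^ suc d ≈ 1#
      square-root {x} x≉0 = begin
        (x * x) ^ suc d            ≈⟨ ^-distrib-* x x (suc d) ⟩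
        x ^ suc d * x ^ suc d      ≈⟨ ^-homo-* x (suc d) (suc d) ⟨
        x ^ (suc d ℕ.+ suc d)      ≈⟨ reflexive (≡.cong (x ^_) n≡e+e) ⟨
        x ^ n                      ≈⟨ fermat x≉0 ⟩
        1#                         ∎

      class-size≤ : length (filter C? nonzeros) ℕ.≤ d
      class-size≤ = ℕ.≤-pred (ℕ.≤-trans
        (ℕ.≤-reflexive (≡.cong suc (≡.sym (List.length-map square members))))
        (ℕ.≤-trans (roots≤degree X^[1+ d ]-1 (t≉squares ∷ distinct) (root-X^[1+_]-1 d t^e≈1 ∷ roots))
                   (ℕ.≤-reflexive (length-X^[1+_]-1 d))))
        where
        members = filter C? nonzeros
        square : Carrier → Carrier
        square x = x * x
        distinct : AllPairs _≉_ (map square members)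
        distinct = AllPairsₚ.map⁺ (allPairs-restrict (Allₚ.all-filter C? nonzeros)
          (AllPairsₚ.filter⁺ C? (AllPairs.map squares-distinct nonzeros-distinct)))
        roots : All (λ s → eval X^[1+ d ]-1 s ≈ 0#) (map square members)
        roots = Allₚ.map⁺ (Allₚ.filter⁺ C? (All.map (root-X^[1+_]-1 d ∘ square-root) nonzeros-≉0))
        t≉squares : All (t ≉_) (map square members)
        t≉squares = Allₚ.map⁺ (All.universal (λ x t≈xx → t-nonsquare (x , sym t≈xx)) members)

    euler : ∀ {e x} → n ≡ e ℕ.+ e → x ^ e ≈ 1# → IsSquare x
    euler {zero}  n≡0 _ = contradiction n≡0 n≢0
    euler {suc d} {x} n≡e+e x^e≈1 with isSquare? x
    ... | yes x-square    = x-square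
    ... | no  x-nonsquare =
      ⊥-elim (ℕ.<⇒≱ (ℕ.+-mono-< (ℕ.n<1+n d) (ℕ.n<1+n d)) (≡.subst (ℕ._≤ d ℕ.+ d) n≡e+e n≤d+d))
      where
      2≉0 : 1# + 1# ≉ 0#
      2≉0 = two≉0 {suc d} n≡e+e
      n≤d+d : n ℕ.≤ d ℕ.+ d
      n≤d+d = ℕ.≤-trans (ℕ.≤-reflexive (≡.sym (List.length-tabulate nonzero)))
        (ℕ.≤-trans (length≤filter+filter Upper? Lower? (All.map (upper⊎lower 2≉0) nonzeros-≉0))
          (ℕ.+-mono-≤ (class-size≤ Upper? upper-no-antipodes n≡e+e x-nonsquare x^e≈1)
                      (class-size≤ Lower? lower-no-antipodes n≡e+e x-nonsquare x^e≈1)))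

    -- With Q = 1 + 2a, |M| − 1 = 2e for e = 2a(a + 1), and t^(2a) = 1 implies t^e = 1.
    fixed-by-^Q⇒isSquare : ∀ {Q t} → Odd Q → suc n ≡ Q ℕ.* Q → t ^ Q ≈ t → IsSquare t
    fixed-by-^Q⇒isSquare {Q} {t} (a , Q≡1+2a) card≡Q² t^Q≈t with t ≈? 0#
    ... | yes t≈0 = 0# , trans (zeroˡ 0#) (sym t≈0)
    ... | no  t≉0 = euler {e} n≡e+e (begin
      t ^ e                        ≈⟨ ^-assocʳ t (a ℕ.+ a) (suc a) ⟨
      (t ^ (a ℕ.+ a)) ^ suc a      ≈⟨ ^-congˡ (suc a) t^[a+a]≈1 ⟩
      1# ^ suc a                   ≈⟨ 1^≈1 (suc a) ⟩
      1#                           ∎)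
      where
      e = (a ℕ.+ a) ℕ.* suc a
      n≡e+e : n ≡ e ℕ.+ e
      n≡e+e = ℕ.suc-injective (≡.trans card≡Q² (≡.trans (≡.cong (λ q → q ℕ.* q) Q≡1+2a) (square a)))
        where
        square : ∀ a → suc (a ℕ.+ a) ℕ.* suc (a ℕ.+ a)
                     ≡ suc ((a ℕ.+ a) ℕ.* suc a ℕ.+ (a ℕ.+ a) ℕ.* suc a)
        square = solve-∀
      t^[a+a]≈1 : t ^ (a ℕ.+ a) ≈ 1#
      t^[a+a]≈1 = *-cancelˡ t≉0 (begin
        t * t ^ (a ℕ.+ a)   ≈⟨ reflexive (≡.cong (t ^_) Q≡1+2a) ⟨
        t ^ Q               ≈⟨ t^Q≈t ⟩
        t                   ≈⟨ *-identityʳ t ⟨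
        t * 1#              ∎)
      1^≈1 : ∀ k → 1# ^ k ≈ 1#
      1^≈1 zero    = refl
      1^≈1 (suc k) = trans (*-identityˡ _) (1^≈1 k)

    injective⇒bijective : ∀ {f : Carrier → Carrier} → (∀ {x y} → x ≈ y → f x ≈ f y)
                        → (∀ {x y} → f x ≈ f y → x ≈ y) → Bijective _≈_ _≈_ f
    injective⇒bijective {f} f-cong f-injective = f-injective , surjective
      where
      f̂ : Fin (suc n) → Fin (suc n)
      f̂ i = index (f (enum i))
      surjective : ∀ y → ∃ λ x → ∀ {z} → z ≈ x → f z ≈ y
      surjective y with injective⇒surjective f̂ (enum-injective ∘ f-injective ∘ index-injective) (index y)
      ... | i , f̂i≡y = enum i , λ z≈x → trans (f-cong z≈x) (index-injective f̂i≡y)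

module TwistedFrobeniusMap {c ℓ} (M : CommutativeRing c ℓ) (isField : IsField M) where
  open CommutativeRing M
  open IsField isField
  open FieldNotions M
  open Field M isField
  open import Algebra.Properties.Semiring.Mult semiring using (_×_)
  open import Algebra.Properties.Semiring.Exp semiring using (_^_; ^-congˡ; ^-homo-*)
  open import Algebra.Properties.CommutativeSemiring.Exp commutativeSemiring using (^-distrib-*)
  open import Algebra.Properties.Group +-group using (inverseˡ-unique)
  open import Algebra.Properties.Ring ring using (-‿distribˡ-*)
  open import Algebra.Solver.Ring.NaturalCoefficients.Default commutativeSemiring
  open import Function.Bundles using (Inverse)
  open import Function.Definitions using (Bijective)
  open import Relation.Binary.Reasoning.Setoid setoid
  open Frobenius M using (frobenius-^; frobenius-^-neg)
  open GroupHomomorphism +-group using (trivial-kernel⇒injective)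

  pow-cong : ∀ k {x y} → x ≈ y → pow x k ≈ pow y k
  pow-cong k {x} {y} x≈y = trans (pow≈^ x k) (trans (^-congˡ k x≈y) (sym (pow≈^ y k)))

  fmap-cong : ∀ r A v {x y} → x ≈ y → fmap r A v x ≈ fmap r A v y
  fmap-cong r A v x≈y = +-cong (*-congʳ (pow-cong r x≈y)) (*-congʳ (*-congˡ x≈y))

  fmap-+ : ∀ {p} → Prime p → p × 1# ≈ 0# → ∀ j A v x y
         → fmap (p ℕ.^ j) A v (x + y) ≈ fmap (p ℕ.^ j) A v x + fmap (p ℕ.^ j) A v y
  fmap-+ {p} p-prime char j A v x y = begin
    pow (x + y) r * v + (A * (x + y)) * V         ≈⟨ +-congʳ (*-congʳ pow-additive) ⟩
    (pow x r + pow y r) * v + (A * (x + y)) * V   ≈⟨ regroup (pow x r) (pow y r) v A x y V ⟩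
    fmap r A v x + fmap r A v y                   ∎
    where
    r = p ℕ.^ j
    V = pow v r
    regroup : ∀ X Y v A x y V → (X + Y) * v + (A * (x + y)) * V ≈ (X * v + (A * x) * V) + (Y * v + (A * y) * V)
    regroup = solve 7 (λ X Y v A x y V → (X :+ Y) :* v :+ (A :* (x :+ y)) :* V
                                      := (X :* v :+ (A :* x) :* V) :+ (Y :* v :+ (A :* y) :* V)) refl
    pow-additive : pow (x + y) r ≈ pow x r + pow y r
    pow-additive = begin
      pow (x + y) r      ≈⟨ pow≈^ (x + y) r ⟩
      (x + y) ^ r        ≈⟨ frobenius-^ p-prime char j x y ⟩
      x ^ r + y ^ r      ≈⟨ +-cong (pow≈^ x r) (pow≈^ y r) ⟨
      pow x r + pow y r  ∎

  -- Writing x = u v and r = 1 + 2s gives f(x) = u v v^r ((u^s)² + A), so a nonzero root x forces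
  -- -A = (u^s)², and then B = -AB / (u^s)² would be a square.
  fmap-≉0 : ∀ {r A B v x} → Odd r → ¬ IsSquare B → IsSquare (- (A * B)) → v ≉ 0# → x ≉ 0#
          → fmap r A v x ≉ 0#
  fmap-≉0 {r} {A} {B} {v} {x} (s , r≡1+2s) B-nonsquare -AB-square v≉0 x≉0 fx≈0 with inverse v v≉0
  ... | v⁻¹ , v*v⁻¹≈1 = B-nonsquare (square-cancelˡ (^-≉0 u≉0 s)
        (proj₁ -AB-square , trans (proj₂ -AB-square) -AB≈wwB))
    where
    u = x * v⁻¹
    w = u ^ s
    V = pow v r
    u≉0 : u ≉ 0#
    u≉0 = *-≉0 x≉0 (λ v⁻¹≈0 → 1≉0 (trans (sym v*v⁻¹≈1) (trans (*-congˡ v⁻¹≈0) (zeroʳ v))))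
    x≈uv : x ≈ u * v
    x≈uv = sym (trans (*-assoc x v⁻¹ v) (trans (*-congˡ (trans (*-comm v⁻¹ v) v*v⁻¹≈1)) (*-identityʳ x)))
    factor : fmap r A v x ≈ (u * (v * V)) * (w * w + A)
    factor = begin
      pow x r * v + (A * x) * V
        ≈⟨ fmap-cong r A v x≈uv ⟩
      pow (u * v) r * v + (A * (u * v)) * V
        ≈⟨ +-congʳ (*-congʳ (trans (pow≈^ (u * v) r) (^-distrib-* u v r))) ⟩
      (u ^ r * v ^ r) * v + (A * (u * v)) * V
        ≈⟨ +-congʳ (*-congʳ (*-cong u^r≈uww (sym (pow≈^ v r)))) ⟩
      ((u * (w * w)) * V) * v + (A * (u * v)) * V
        ≈⟨ solve 5 (λ u ww V v A → ((u :* ww) :* V) :* v :+ (A :* (u :* v)) :* V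
                                 := (u :* (v :* V)) :* (ww :+ A)) refl u (w * w) V v A ⟩
      (u * (v * V)) * (w * w + A) ∎
      where
      u^r≈uww : u ^ r ≈ u * (w * w)
      u^r≈uww = trans (reflexive (≡.cong (u ^_) r≡1+2s)) (*-congˡ (^-homo-* u s s))
    ww+A≈0 : w * w + A ≈ 0#
    ww+A≈0 = x*y≈0⇒y≈0 (*-≉0 u≉0 (*-≉0 v≉0 V≉0)) (trans (sym factor) fx≈0)
      where
      V≉0 : V ≉ 0#
      V≉0 = ^-≉0 v≉0 r ∘ trans (sym (pow≈^ v r))
    -AB≈wwB : - (A * B) ≈ (w * w) * B
    -AB≈wwB = trans (-‿distribˡ-* A B) (*-congʳ (sym (inverseˡ-unique (w * w) A ww+A≈0)))

  fmap-bijective : ∀ {N p h A B v} k → HasCard M N → N ≡ p ℕ.^ h ℕ.* p ℕ.^ h → Prime p → Odd p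
                 → ¬ IsSquare B → InSubfieldUnits (p ℕ.^ h) (A * B) → v ≉ 0#
                 → Bijective _≈_ _≈_ (fmap (p ℕ.^ (k ℕ.+ h)) A v)
  fmap-bijective {zero} k card = contradiction (Inverse.to card 0#) λ ()
  fmap-bijective {suc n} {p} {h} {A} {B} {v} k card card≡Q² p-prime p-odd B-nonsquare (AB^Q≈AB , _) v≉0 =
    injective⇒bijective (fmap-cong r A v)
      (trivial-kernel⇒injective (fmap-cong r A v) (fmap-+ p-prime char (k ℕ.+ h) A v) kernel)
    where
    open Finite card
    r = p ℕ.^ (k ℕ.+ h)
    char : p × 1# ≈ 0#
    char = characteristic {p} {h ℕ.+ h} (≡.trans card≡Q² (≡.sym (ℕ.^-distribˡ-+-* p h h)))
    -AB-square : IsSquare (- (A * B))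
    -AB-square = fixed-by-^Q⇒isSquare (odd-^ p-odd h) card≡Q² (begin
      (- (A * B)) ^ (p ℕ.^ h)    ≈⟨ frobenius-^-neg p-prime char h (A * B) ⟩
      - ((A * B) ^ (p ℕ.^ h))    ≈⟨ -‿cong (trans (sym (pow≈^ (A * B) (p ℕ.^ h))) AB^Q≈AB) ⟩
      - (A * B)                  ∎)
    kernel : ∀ x → fmap r A v x ≈ 0# → x ≈ 0#
    kernel x fx≈0 with x ≈? 0#
    ... | yes x≈0 = x≈0
    ... | no  x≉0 = contradiction fx≈0 (fmap-≉0 (odd-^ p-odd (k ℕ.+ h)) B-nonsquare -AB-square v≉0 x≉0)

open import Data.Nat using (_+_; _*_; _^_; _≤_; _<_)
open import Data.Nat.GCD using (gcd)
open import Function.Definitions using (Bijective)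
open TwistedFrobeniusMap using (fmap-bijective)

lemma4p4 : ∀ {c ℓ} (p m h k : ℕ) → Prime p → ¬ (2 ∣ p)
    → m ≡ 2 * h → 1 ≤ k → k < m
    → (∀ d → d * gcd k m ≡ m → ¬ (2 ∣ d))
    → (M : CommutativeRing c ℓ) → IsField M → HasCard M (p ^ m)
    → (A B : CommutativeRing.Carrier M) → ¬ FieldNotions.IsSquare M B
    → FieldNotions.InSubfieldUnits M (p ^ h) (CommutativeRing._*_ M A B)
    → (v : CommutativeRing.Carrier M) → ¬ (CommutativeRing._≈_ M v (CommutativeRing.0# M))
    → Bijective (CommutativeRing._≈_ M) (CommutativeRing._≈_ M) (FieldNotions.fmap M (p ^ (k + h)) A v)
lemma4p4 p m h k p-prime 2∤p m≡2h _ _ _ M isField card A B B-nonsquare AB∈F_Q v v≉0 =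
  fmap-bijective M isField k card pᵐ≡Q² p-prime (¬2∣⇒odd 2∤p) B-nonsquare AB∈F_Q v≉0
  where
  pᵐ≡Q² : p ^ m ≡ p ^ h * p ^ h
  pᵐ≡Q² = ≡.trans (≡.cong (p ^_) (≡.trans m≡2h (≡.cong (h +_) (ℕ.+-identityʳ h))))
                  (ℕ.^-distribˡ-+-* p h h)
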